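{- Let $n,w>1$ be integers and $k$ an integer with $-n/(w-1)\le k\le n$. Let $\lambda$ be a Young diagram with $n+k(w-1)$ boxes and at most $w$ columns, contained in the rectangle with $w$ columns and $n$ rows, and let $A$ be a semistandard Young tableau of shape $\square_{w,n}-\lambda$ whose content consists of exactly $w-1$ copies of each of $1,\ldots,n-k$. Then $\overline{A}^{w,n-k}$ contains exactly one copy of each element of $[n-k]$.
   Context: Young diagrams are described by column lengths $\lambda_i$. For $\lambda$ contained in the rectangle $\square_{w,n}$ ($w$ columns, $n$ rows), $\square_{w,n}-\lambda$ is the Young diagram whose $i$-th column has length $n-\lambda_{w-i+1}$, $1\le i\le w$. Semistandard: columns strictly increasing, rows weakly increasing. For a tableau $A$ with columns $A_1,\ldots,A_w$ (possibly empty) and entries in $[N]$, the tableau complement $\overline{A}^{w,N}$ has $i$-th column equal to $[N]\setminus A_{w-i+1}$ in increasing order, for $1\le i\le w$. -}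

module Defs where

open import Data.Nat using (ℕ; zero; suc; _+_; _∸_; _≤_; _<_; _≟_; _≤?_)
open import Data.Fin as Fin using (Fin; opposite)
open import Data.List using (List; []; _∷_; length; map; concat; upTo; allFin; filter)
open import Data.List.Relation.Unary.Linked using (Linked)
open import Data.List.Membership.DecPropositional _≟_ using (_∈?_)
open import Data.Bool using (if_then_else_)
open import Relation.Nullary using (¬?; does)
open import Relation.Nullary.Decidable using (_×-dec_)
open import Relation.Binary.PropositionalEquality using (_≡_)

-- A Young diagram with (at most) w columns, given by its column lengths
-- λ 0, ..., λ (w-1)  (0-indexed; zero-length columns allowed).
ColumnLengths : ℕ → Set
ColumnLengths w = Fin w → ℕ

IsYoungDiagram : ∀ {w} → ColumnLengths w → Set
IsYoungDiagram {w} λ' = ∀ (i j : Fin w) → i Fin.≤ j → λ' j ≤ λ' i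

ContainedInRect : ∀ {w} → ℕ → ColumnLengths w → Set
ContainedInRect {w} n λ' = ∀ (i : Fin w) → λ' i ≤ n

sumFin : ∀ {w} → (Fin w → ℕ) → ℕ
sumFin {zero}  f = 0
sumFin {suc w} f = f Fin.zero + sumFin (λ i → f (Fin.suc i))

boxes : ∀ {w} → ColumnLengths w → ℕ
boxes = sumFin

-- □_{w,n} − λ : i-th column has length n − λ_{w−i+1}
rectMinus : ∀ {w} → ℕ → ColumnLengths w → ColumnLengths w
rectMinus n λ' i = n ∸ λ' (opposite i)

-- A tableau with w columns; each column listed top to bottom
Tableau : ℕ → Set
Tableau w = Fin w → List ℕ

HasShape : ∀ {w} → Tableau w → ColumnLengths w → Set
HasShape {w} A μ = ∀ (i : Fin w) → length (A i) ≡ μ i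

data _at_≡_ : List ℕ → ℕ → ℕ → Set where
  here  : ∀ {x xs} → (x ∷ xs) at 0 ≡ x
  there : ∀ {x xs r y} → xs at r ≡ y → (x ∷ xs) at suc r ≡ y

IsSemistandard : ∀ {w} → Tableau w → Set
IsSemistandard {w} A =
  (∀ (i : Fin w) → Linked _<_ (A i)) ×'
  (∀ (i j : Fin w) → i Fin.< j → ∀ r x y → A i at r ≡ x → A j at r ≡ y → x ≤ y)
  where
  open import Data.Product using () renaming (_×_ to _×'_)

count : ℕ → List ℕ → ℕ
count v []       = 0
count v (x ∷ xs) = (if does (x ≟ v) then 1 else 0) + count v xs

entries : ∀ {w} → Tableau w → List ℕ
entries {w} A = concat (map A (allFin w))

range1 : ℕ → List ℕ
range1 N = map suc (upTo N)

inRange1 : ℕ → ℕ → Set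
inRange1 N v = (1 ≤ v) Data.Product.× (v ≤ N)
  where import Data.Product

multOf : ℕ → ℕ → ℕ → ℕ
multOf m N v = if does ((1 ≤? v) ×-dec (v ≤? N)) then m else 0

HasContent : ∀ {w} → Tableau w → (ℕ → ℕ) → Set
HasContent A c = ∀ (v : ℕ) → count v (entries A) ≡ c v

-- tableau complement: i-th column = [N] \ A_{w−i+1}, increasing
complement : ∀ {w} → ℕ → Tableau w → Tableau w
complement N A i = filter (λ v → ¬? (v ∈? A (opposite i))) (range1 N)

module Submission where

-- Of all the hypotheses only two matter: the columns of A are
-- strictly increasing, and each v ∈ [N] (N = |n - k|) occurs exactly w - 1
-- times in A while no other value occurs.  A strictly increasing column
-- contains v at most once, so the number of occurrences of v in A is the
-- number of columns of A containing v.  Hence for v ∈ [N] exactly one of the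
-- w columns of A misses v.  Column i of the complement is [N] minus column
-- w-1-i of A, so v occurs in it exactly when that column of A misses v: in
-- total v occurs once.  Values outside [N] never occur in the complement.

open import Defs
open import Data.Nat using (ℕ; _<_; _∸_)
open import Data.Integer using (ℤ; +_; -_; _+_; _-_; _*_; _≤_; ∣_∣)
open import Relation.Binary.PropositionalEquality using (_≡_)

import Data.Nat as ℕ
import Data.Nat.Properties as ℕₚ
open import Algebra.Properties.CommutativeSemigroup ℕₚ.+-commutativeSemigroup
  using (interchange)
open import Data.Bool using (Bool; true; false; not; if_then_else_)
open import Data.Fin as Fin using (Fin; opposite; inject₁; fromℕ)
open import Data.List using (List; []; _∷_; _++_; concat; tabulate; filter)
import Data.List.Properties as Listₚ
import Data.List.Relation.Unary.All as All
open import Data.List.Relation.Unary.Any using (here; there)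
open import Data.List.Relation.Unary.Linked as Linked using (Linked)
open import Data.List.Relation.Unary.Linked.Properties
  using (Linked⇒AllPairs; applyUpTo⁺₂) renaming (map⁺ to Linked-map⁺)
open import Data.List.Relation.Unary.AllPairs using (_∷_)
open import Data.List.Membership.Propositional using (_∈_; _∉_)
open import Data.List.Membership.Propositional.Properties
  using (∈-map⁺; ∈-map⁻; ∈-upTo⁺; ∈-upTo⁻; ∈-filter⁻)
open import Data.List.Membership.DecPropositional ℕ._≟_ using (_∈?_)
open import Data.Product using (_,_; proj₁; proj₂)
open import Data.Empty using (⊥-elim)
open import Function using (_∘_)
open import Relation.Nullary using (¬_; ¬?; Dec; does; yes; no)
open import Relation.Nullary.Decidable using (_×-dec_; dec-true; dec-false)
open import Relation.Unary using (Pred; Decidable)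
open import Relation.Binary.PropositionalEquality
  using (_≢_; refl; sym; trans; cong; cong₂; module ≡-Reasoning)

indicator : Bool → ℕ
indicator b = if b then 1 else 0

count-++ : ∀ v xs ys → count v (xs ++ ys) ≡ count v xs ℕ.+ count v ys
count-++ v []       ys = refl
count-++ v (x ∷ xs) ys =
  trans (cong (_ ℕ.+_) (count-++ v xs ys))
        (sym (ℕₚ.+-assoc (indicator (does (x ℕ.≟ v))) (count v xs) (count v ys)))

count-concat : ∀ v {w} (h : Fin w → List ℕ) →
  count v (concat (tabulate h)) ≡ sumFin (λ i → count v (h i))
count-concat v {ℕ.zero}  h = refl
count-concat v {ℕ.suc w} h =
  trans (count-++ v (h Fin.zero) _)
        (cong (count v (h Fin.zero) ℕ.+_) (count-concat v (λ i → h (Fin.suc i))))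

count-entries : ∀ v {w} (B : Tableau w) →
  count v (entries B) ≡ sumFin (λ i → count v (B i))
count-entries v B =
  trans (cong (count v ∘ concat) (Listₚ.map-tabulate (λ i → i) B)) (count-concat v B)

count-head-≡ : ∀ v xs → count v (v ∷ xs) ≡ ℕ.suc (count v xs)
count-head-≡ v xs = cong (λ b → indicator b ℕ.+ count v xs) (dec-true (v ℕ.≟ v) refl)

count-head-≢ : ∀ {x v} xs → x ≢ v → count v (x ∷ xs) ≡ count v xs
count-head-≢ {x} {v} xs x≢v = cong (λ b → indicator b ℕ.+ count v xs) (dec-false (x ℕ.≟ v) x≢v)

count-∉ : ∀ {v} xs → v ∉ xs → count v xs ≡ 0
count-∉ []       v∉ = refl
count-∉ (x ∷ xs) v∉ =
  trans (count-head-≢ {x} xs (λ { refl → v∉ (here refl) })) (count-∉ xs (v∉ ∘ there))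

head-∉-tail : ∀ {x xs} → Linked _<_ (x ∷ xs) → x ∉ xs
head-∉-tail l x∈xs with Linked⇒AllPairs ℕₚ.<-trans l
... | x<xs ∷ _ = ℕₚ.<-irrefl refl (All.lookup x<xs x∈xs)

count-strict-∈ : ∀ {v xs} → Linked _<_ xs → v ∈ xs → count v xs ≡ 1
count-strict-∈ {v} {x ∷ xs} l v∈ with x ℕ.≟ v
count-strict-∈ {v} {v ∷ xs} l _           | yes refl =
  trans (count-head-≡ v xs) (cong ℕ.suc (count-∉ xs (head-∉-tail l)))
count-strict-∈ l           (here x≡v)     | no  x≢v  = ⊥-elim (x≢v (sym x≡v))
count-strict-∈ {xs = _ ∷ xs} l (there v∈) | no  x≢v  =
  trans (count-head-≢ xs x≢v) (count-strict-∈ (Linked.tail l) v∈)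

count-filter-accept : ∀ {p} {P : Pred ℕ p} (P? : Decidable P) {v} → P v →
  ∀ ys → count v (filter P? ys) ≡ count v ys
count-filter-accept P? Pv []       = refl
count-filter-accept P? {v} Pv (x ∷ ys) with P? x | x ℕ.≟ v
... | yes _   | yes refl = cong (_ ℕ.+_) (count-filter-accept P? Pv ys)
... | yes _   | no  x≢v  = trans (count-head-≢ (filter P? ys) x≢v)
                                 (trans (count-filter-accept P? Pv ys) (sym (count-head-≢ ys x≢v)))
... | no  ¬Px | yes refl = ⊥-elim (¬Px Pv)
... | no  _   | no  x≢v  = trans (count-filter-accept P? Pv ys) (sym (count-head-≢ ys x≢v))

count-filter-reject : ∀ {p} {P : Pred ℕ p} (P? : Decidable P) {v} → ¬ P v →
  ∀ ys → count v (filter P? ys) ≡ 0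
count-filter-reject P? ¬Pv ys = count-∉ (filter P? ys) (¬Pv ∘ proj₂ ∘ ∈-filter⁻ P? {xs = ys})

inRange1? : ∀ N v → Dec (inRange1 N v)
inRange1? N v = (1 ℕ.≤? v) ×-dec (v ℕ.≤? N)

range1-strict : ∀ N → Linked _<_ (range1 N)
range1-strict N = Linked-map⁺ (applyUpTo⁺₂ (λ i → i) N (λ i → ℕₚ.n<1+n (ℕ.suc i)))

∈-range1⁺ : ∀ {N v} → inRange1 N v → v ∈ range1 N
∈-range1⁺ {v = ℕ.suc u} (_ , v≤N) = ∈-map⁺ ℕ.suc (∈-upTo⁺ v≤N)

∈-range1⁻ : ∀ {N v} → v ∈ range1 N → inRange1 N v
∈-range1⁻ v∈ with ∈-map⁻ ℕ.suc v∈
... | u , u∈ , refl = ℕ.s≤s ℕ.z≤n , ∈-upTo⁻ u∈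

multOf-in : ∀ m {N v} → inRange1 N v → multOf m N v ≡ m
multOf-in m {N} {v} r = cong (if_then m else 0) (dec-true (inRange1? N v) r)

multOf-out : ∀ m {N v} → ¬ inRange1 N v → multOf m N v ≡ 0
multOf-out m {N} {v} ¬r = cong (if_then m else 0) (dec-false (inRange1? N v) ¬r)

sum-cong : ∀ {w} {f g : Fin w → ℕ} → (∀ i → f i ≡ g i) → sumFin f ≡ sumFin g
sum-cong {ℕ.zero}  f≡g = refl
sum-cong {ℕ.suc w} f≡g = cong₂ ℕ._+_ (f≡g Fin.zero) (sum-cong (f≡g ∘ Fin.suc))

sum-zero : ∀ w → sumFin {w} (λ _ → 0) ≡ 0
sum-zero ℕ.zero    = refl
sum-zero (ℕ.suc w) = sum-zero w

sum-last : ∀ {w} (f : Fin (ℕ.suc w) → ℕ) →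
  sumFin f ≡ sumFin (f ∘ inject₁) ℕ.+ f (fromℕ w)
sum-last {ℕ.zero}  f = ℕₚ.+-comm (f Fin.zero) 0
sum-last {ℕ.suc w} f =
  trans (cong (f Fin.zero ℕ.+_) (sum-last (f ∘ Fin.suc)))
        (sym (ℕₚ.+-assoc (f Fin.zero) _ _))

sum-opposite : ∀ {w} (f : Fin w → ℕ) → sumFin (f ∘ opposite) ≡ sumFin f
sum-opposite {ℕ.zero}  f = refl
sum-opposite {ℕ.suc w} f = begin
  f (fromℕ w) ℕ.+ sumFin (f ∘ inject₁ ∘ opposite) ≡⟨ cong (f (fromℕ w) ℕ.+_) (sum-opposite (f ∘ inject₁)) ⟩
  f (fromℕ w) ℕ.+ sumFin (f ∘ inject₁)            ≡⟨ ℕₚ.+-comm (f (fromℕ w)) _ ⟩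
  sumFin (f ∘ inject₁) ℕ.+ f (fromℕ w)            ≡⟨ sum-last f ⟨
  sumFin f                                        ∎
  where open ≡-Reasoning

countTrue : ∀ {w} → (Fin w → Bool) → ℕ
countTrue d = sumFin (indicator ∘ d)

indicator-split : ∀ b → indicator (not b) ℕ.+ indicator b ≡ 1
indicator-split true  = refl
indicator-split false = refl

countTrue-split : ∀ {w} (d : Fin w → Bool) → countTrue (not ∘ d) ℕ.+ countTrue d ≡ w
countTrue-split {ℕ.zero}  d = refl
countTrue-split {ℕ.suc w} d =
  trans (interchange (indicator (not (d Fin.zero))) _ (indicator (d Fin.zero)) _)
        (cong₂ ℕ._+_ (indicator-split (d Fin.zero)) (countTrue-split (d ∘ Fin.suc)))

exactly-one-missing : ∀ {w} (d : Fin (ℕ.suc w) → Bool) → countTrue d ≡ w →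
  countTrue (not ∘ d) ≡ 1
exactly-one-missing {w} d all-but-one =
  ℕₚ.+-cancelʳ-≡ w _ 1
    (trans (cong (countTrue (not ∘ d) ℕ.+_) (sym all-but-one)) (countTrue-split d))

count-strict-tableau : ∀ {w} (A : Tableau w) → (∀ i → Linked _<_ (A i)) →
  ∀ v → count v (entries A) ≡ countTrue (λ i → does (v ∈? A i))
count-strict-tableau A strict v =
  trans (count-entries v A) (sum-cong column)
  where
  column : ∀ i → count v (A i) ≡ indicator (does (v ∈? A i))
  column i with v ∈? A i
  ... | yes v∈ = count-strict-∈ (strict i) v∈
  ... | no  v∉ = count-∉ (A i) v∉

count-complement-column : ∀ {w N v} (A : Tableau w) → inRange1 N v → ∀ i →
  count v (complement N A i) ≡ indicator (not (does (v ∈? A (opposite i))))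
count-complement-column {N = N} {v} A r i with v ∈? A (opposite i)
... | yes v∈ = count-filter-reject (λ u → ¬? (u ∈? A (opposite i))) (λ v∉ → v∉ v∈) (range1 N)
... | no  v∉ = trans (count-filter-accept (λ u → ¬? (u ∈? A (opposite i))) v∉ (range1 N))
                     (count-strict-∈ (range1-strict N) (∈-range1⁺ r))

count-complement-in : ∀ {w N v} (A : Tableau w) → inRange1 N v →
  count v (entries (complement N A)) ≡ countTrue (λ i → not (does (v ∈? A i)))
count-complement-in {N = N} {v} A r =
  trans (count-entries v (complement N A))
        (trans (sum-cong (count-complement-column A r))
               (sum-opposite (λ i → indicator (not (does (v ∈? A i))))))

count-complement-out : ∀ {w N v} (A : Tableau w) → ¬ inRange1 N v →
  count v (entries (complement N A)) ≡ 0
count-complement-out {w} {N} {v} A ¬r =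
  trans (count-entries v (complement N A)) (trans (sum-cong column) (sum-zero w))
  where
  column : ∀ i → count v (complement N A i) ≡ 0
  column i = count-∉ (complement N A i)
    (¬r ∘ ∈-range1⁻ ∘ proj₁ ∘ ∈-filter⁻ (λ u → ¬? (u ∈? A (opposite i))) {xs = range1 N})

claim4p5 : (n w : ℕ) → 1 < n → 1 < w → (k : ℤ) →
    - (+ n) ≤ k * (+ (w ∸ 1)) → k ≤ + n →
    (λ' : ColumnLengths w) → IsYoungDiagram λ' → ContainedInRect n λ' →
    + boxes λ' ≡ + n + k * (+ (w ∸ 1)) →
    (A : Tableau w) → HasShape A (rectMinus n λ') → IsSemistandard A →
    HasContent A (multOf (w ∸ 1) ∣ + n - k ∣) →
    HasContent (complement ∣ + n - k ∣ A) (multOf 1 ∣ + n - k ∣)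
claim4p5 n ℕ.zero    _ () k
claim4p5 n (ℕ.suc w) _ _ k _ _ λ' _ _ _ A _ (strict , _) content v
  with inRange1? ∣ + n - k ∣ v
... | yes r = begin
  count v (entries (complement N A))        ≡⟨ count-complement-in A r ⟩
  countTrue (λ i → not (does (v ∈? A i)))   ≡⟨ exactly-one-missing (λ i → does (v ∈? A i)) columns-with-v ⟩
  1                                         ≡⟨ multOf-in 1 r ⟨
  multOf 1 N v                              ∎
  where
  N : ℕ
  N = ∣ + n - k ∣
  open ≡-Reasoning
  columns-with-v : countTrue (λ i → does (v ∈? A i)) ≡ w
  columns-with-v =
    trans (sym (count-strict-tableau A strict v)) (trans (content v) (multOf-in w r))
... | no ¬r = trans (count-complement-out A ¬r) (sym (multOf-out 1 ¬r))
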